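{- Let $H$ be a simple graph on vertices $v_1,\ldots,v_k$ and for $j=1,\ldots,k$ let $G_j = \overline{K_{n_j}}$ be the edgeless graph on $n_j$ vertices. If $n_j > 1$ for each $j = 1,2,\ldots,k$, then the graph $G = H[G_1,G_2,\ldots,G_k]$ is $A$-vertex magic for every Abelian group $A$ with $|A|>2$.
   Context: For a non-trivial Abelian group $A$, a graph $G$ is $A$-vertex magic if there exist a labeling $l : V(G) \to A\setminus\{0\}$ and $\mu \in A$ such that $\sum_{u \in N_G(v)} l(u) = \mu$ for every $v \in V(G)$, where $N_G(v)$ is the open neighborhood of $v$. The $H$-join $H[G_1,\ldots,G_k]$ is obtained by replacing each vertex $v_i$ of $H$ by the graph $G_i$ and joining every vertex of $G_i$ to every vertex of $G_j$ whenever $v_iv_j \in E(H)$; its vertex set is $\bigcup_i V(G_i)$ and its edge set is $\bigcup_i E(G_i) \cup \bigcup_{v_iv_j\in E(H)} \{uv : u \in V(G_i), v\in V(G_j)\}$. -}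

module Defs where

open import Level using (Level; _⊔_)
open import Data.Bool using (Bool; true; false; if_then_else_; _∧_)
open import Data.Nat using (ℕ; _>_)
open import Data.Fin using (Fin; _≟_)
open import Data.List using (List; foldr; map; concatMap; allFin)
open import Data.Product using (Σ; _,_; _×_; ∃)
open import Relation.Nullary using (¬_; does)
open import Relation.Binary.PropositionalEquality using (_≡_)
open import Algebra.Bundles using (AbelianGroup)

-- A finite simple graph: a vertex type with an explicit enumeration of its
-- vertices (each vertex listed exactly once), and a decidable (Bool-valued)
-- symmetric irreflexive adjacency relation.
record FinGraph : Set₁ where
  field
    V      : Set
    elems  : List V
    adj    : V → V → Bool
    sym    : ∀ u v → adj u v ≡ adj v u
    irrefl : ∀ v → adj v v ≡ false
open FinGraph public

record SimpleGraph (k : ℕ) : Set where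
  field
    E      : Fin k → Fin k → Bool
    E-sym  : ∀ i j → E i j ≡ E j i
    E-irr  : ∀ i → E i i ≡ false
open SimpleGraph public

Edgeless : ℕ → FinGraph
Edgeless n = record
  { V = Fin n ; elems = allFin n ; adj = λ _ _ → false
  ; sym = λ _ _ → Relation.Binary.PropositionalEquality.refl
  ; irrefl = λ _ → Relation.Binary.PropositionalEquality.refl }

joinAdj : ∀ {k} (H : SimpleGraph k) (G : Fin k → FinGraph) →
          Σ (Fin k) (λ j → V (G j)) → Σ (Fin k) (λ j → V (G j)) → Bool
joinAdj {k} H G (j , a) (i , b) with j ≟ i
... | Relation.Nullary.yes Relation.Binary.PropositionalEquality.refl = adj (G j) a b
... | Relation.Nullary.no _ = E H j i

joinAdj-sym : ∀ {k} (H : SimpleGraph k) (G : Fin k → FinGraph) u v →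
              joinAdj H G u v ≡ joinAdj H G v u
joinAdj-sym H G (j , a) (i , b) with j ≟ i | i ≟ j
... | Relation.Nullary.yes Relation.Binary.PropositionalEquality.refl
    | Relation.Nullary.yes Relation.Binary.PropositionalEquality.refl = sym (G j) a b
... | Relation.Nullary.yes Relation.Binary.PropositionalEquality.refl | Relation.Nullary.no ¬p =
      Data.Empty.⊥-elim (¬p Relation.Binary.PropositionalEquality.refl)
  where import Data.Empty
... | Relation.Nullary.no ¬p | Relation.Nullary.yes Relation.Binary.PropositionalEquality.refl =
      Data.Empty.⊥-elim (¬p Relation.Binary.PropositionalEquality.refl)
  where import Data.Empty
... | Relation.Nullary.no _ | Relation.Nullary.no _ = E-sym H j i

joinAdj-irr : ∀ {k} (H : SimpleGraph k) (G : Fin k → FinGraph) v →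
              joinAdj H G v v ≡ false
joinAdj-irr H G (j , a) with j ≟ j
... | Relation.Nullary.yes Relation.Binary.PropositionalEquality.refl = irrefl (G j) a
... | Relation.Nullary.no ¬p = Data.Empty.⊥-elim (¬p Relation.Binary.PropositionalEquality.refl)
  where import Data.Empty

Join : ∀ {k} → SimpleGraph k → (Fin k → FinGraph) → FinGraph
Join {k} H G = record
  { V = Σ (Fin k) (λ j → V (G j))
  ; elems = concatMap (λ j → map (λ a → (j , a)) (elems (G j))) (allFin k)
  ; adj = joinAdj H G
  ; sym = joinAdj-sym H G
  ; irrefl = joinAdj-irr H G }

module _ {c ℓ} (A : AbelianGroup c ℓ) where
  open AbelianGroup A

  nbrSum : (G : FinGraph) → (V G → Carrier) → V G → Carrier
  nbrSum G l v = foldr (λ u acc → if adj G v u then l u ∙ acc else acc) ε (elems G)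

  VertexMagic : FinGraph → Set (c ⊔ ℓ)
  VertexMagic G = Σ (V G → Carrier) λ l → Σ Carrier λ μ →
    (∀ u → ¬ (l u ≈ ε)) × (∀ v → nbrSum G l v ≈ μ)

  MoreThanTwo : Set (c ⊔ ℓ)
  MoreThanTwo = Σ Carrier λ x → Σ Carrier λ y → Σ Carrier λ z →
    ¬ (x ≈ y) × ¬ (x ≈ z) × ¬ (y ≈ z)

-- In a join of edgeless graphs every vertex is adjacent either to all or to
-- none of the vertices of each block, so its neighbourhood is a union of whole
-- blocks.  Labelling each block by nonzero elements summing to 0 therefore
-- makes every neighbourhood sum 0.  Three distinct elements x, y, z supply such
-- labellings of every block of size at least 2: pairs y - x, x - y, padded by
-- one triple y - x, x - z, z - y for odd sizes.
module Submission where

open import Defs hiding (sym)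
open import Algebra.Bundles using (Monoid; Group; AbelianGroup)
open import Data.Bool using (Bool; true; false; if_then_else_)
open import Data.Fin using (Fin; zero; suc; _≟_)
open import Data.List using (List; []; _∷_; _++_; foldr; map; concatMap; tabulate; allFin)
open import Data.List.Properties using (map-tabulate)
open import Data.Nat as ℕ using (ℕ; _>_; s≤s; z≤n)
open import Data.Product using (_,_)
open import Data.Vec.Functional using (Vector)
open import Function using (_∘_)
open import Relation.Nullary using (¬_; yes; no)
open import Relation.Binary.PropositionalEquality as ≡ using (_≡_)
import Algebra.Definitions.RawMonoid as RawMonoidDefinitions
import Algebra.Properties.Group as GroupProperties
import Relation.Binary.Reasoning.Setoid as SetoidReasoning

module ConditionalSum {c ℓ} (M : Monoid c ℓ) where
  open Monoid M
  open RawMonoidDefinitions rawMonoid using (sum)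
  open SetoidReasoning setoid

  condSum : {X : Set} → (X → Bool) → (X → Carrier) → List X → Carrier
  condSum p l = foldr (λ u acc → if p u then l u ∙ acc else acc) ε

  module _ {X : Set} (p : X → Bool) (l : X → Carrier) where

    condSum-++ : ∀ xs ys → condSum p l (xs ++ ys) ≈ condSum p l xs ∙ condSum p l ys
    condSum-++ []       ys = sym (identityˡ _)
    condSum-++ (x ∷ xs) ys with p x
    ... | true  = trans (∙-congˡ (condSum-++ xs ys)) (sym (assoc _ _ _))
    ... | false = condSum-++ xs ys

    condSum-concatMap-≈ε : {Y : Set} (f : Y → List X) → (∀ y → condSum p l (f y) ≈ ε) →
                           ∀ ys → condSum p l (concatMap f ys) ≈ ε
    condSum-concatMap-≈ε f f≈ε []       = refl
    condSum-concatMap-≈ε f f≈ε (y ∷ ys) = begin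
      condSum p l (f y ++ concatMap f ys)              ≈⟨ condSum-++ (f y) (concatMap f ys) ⟩
      condSum p l (f y) ∙ condSum p l (concatMap f ys) ≈⟨ ∙-cong (f≈ε y) (condSum-concatMap-≈ε f f≈ε ys) ⟩
      ε ∙ ε                                            ≈⟨ identityˡ ε ⟩
      ε                                                ∎

    condSum-tabulate-true : ∀ {n} (f : Fin n → X) → (∀ i → p (f i) ≡ true) →
                            condSum p l (tabulate f) ≡ sum (l ∘ f)
    condSum-tabulate-true {ℕ.zero}  f pf = ≡.refl
    condSum-tabulate-true {ℕ.suc n} f pf rewrite pf zero =
      ≡.cong (l (f zero) ∙_) (condSum-tabulate-true (f ∘ suc) (pf ∘ suc))

    condSum-tabulate-false : ∀ {n} (f : Fin n → X) → (∀ i → p (f i) ≡ false) →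
                             condSum p l (tabulate f) ≡ ε
    condSum-tabulate-false {ℕ.zero}  f pf = ≡.refl
    condSum-tabulate-false {ℕ.suc n} f pf rewrite pf zero =
      condSum-tabulate-false (f ∘ suc) (pf ∘ suc)

module ZeroSumLabelling {c ℓ} (G : Group c ℓ) {x y z : Group.Carrier G}
                        (x≉y : ¬ Group._≈_ G x y) (x≉z : ¬ Group._≈_ G x z) (y≉z : ¬ Group._≈_ G y z) where
  open Group G
  open GroupProperties G using (x∙y⁻¹≈ε⇒x≈y)
  open RawMonoidDefinitions rawMonoid using (sum)
  open SetoidReasoning setoid

  telescope : ∀ u v w → (u ∙ v ⁻¹) ∙ (v ∙ w ⁻¹) ≈ u ∙ w ⁻¹
  telescope u v w = begin
    (u ∙ v ⁻¹) ∙ (v ∙ w ⁻¹) ≈⟨ assoc u (v ⁻¹) (v ∙ w ⁻¹) ⟩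
    u ∙ (v ⁻¹ ∙ (v ∙ w ⁻¹)) ≈⟨ ∙-congˡ (sym (assoc (v ⁻¹) v (w ⁻¹))) ⟩
    u ∙ ((v ⁻¹ ∙ v) ∙ w ⁻¹) ≈⟨ ∙-congˡ (∙-congʳ (inverseˡ v)) ⟩
    u ∙ (ε ∙ w ⁻¹)          ≈⟨ ∙-congˡ (identityˡ (w ⁻¹)) ⟩
    u ∙ w ⁻¹                ∎

  -- A single vertex admits no zero-sum nonzero labelling; its value is arbitrary.
  label : ∀ n → Vector Carrier n
  label 1 _                = y ∙ x ⁻¹
  label 2 zero             = y ∙ x ⁻¹
  label 2 (suc zero)       = x ∙ y ⁻¹
  label 3 zero             = y ∙ x ⁻¹
  label 3 (suc zero)       = x ∙ z ⁻¹
  label 3 (suc (suc zero)) = z ∙ y ⁻¹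
  label (ℕ.suc (ℕ.suc n@(ℕ.suc (ℕ.suc _)))) zero          = y ∙ x ⁻¹
  label (ℕ.suc (ℕ.suc n@(ℕ.suc (ℕ.suc _)))) (suc zero)    = x ∙ y ⁻¹
  label (ℕ.suc (ℕ.suc n@(ℕ.suc (ℕ.suc _)))) (suc (suc i)) = label n i

  label-≉ε : ∀ n i → ¬ label n i ≈ ε
  label-≉ε 1 _                e = x≉y (sym (x∙y⁻¹≈ε⇒x≈y y x e))
  label-≉ε 2 zero             e = x≉y (sym (x∙y⁻¹≈ε⇒x≈y y x e))
  label-≉ε 2 (suc zero)       e = x≉y (x∙y⁻¹≈ε⇒x≈y x y e)
  label-≉ε 3 zero             e = x≉y (sym (x∙y⁻¹≈ε⇒x≈y y x e))
  label-≉ε 3 (suc zero)       e = x≉z (x∙y⁻¹≈ε⇒x≈y x z e)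
  label-≉ε 3 (suc (suc zero)) e = y≉z (sym (x∙y⁻¹≈ε⇒x≈y z y e))
  label-≉ε (ℕ.suc (ℕ.suc (ℕ.suc (ℕ.suc _)))) zero       e = x≉y (sym (x∙y⁻¹≈ε⇒x≈y y x e))
  label-≉ε (ℕ.suc (ℕ.suc (ℕ.suc (ℕ.suc _)))) (suc zero) e = x≉y (x∙y⁻¹≈ε⇒x≈y x y e)
  label-≉ε (ℕ.suc (ℕ.suc n@(ℕ.suc (ℕ.suc _)))) (suc (suc i)) = label-≉ε n i

  sum-pair : ∀ s → (y ∙ x ⁻¹) ∙ ((x ∙ y ⁻¹) ∙ s) ≈ s
  sum-pair s = begin
    (y ∙ x ⁻¹) ∙ ((x ∙ y ⁻¹) ∙ s) ≈⟨ sym (assoc _ _ s) ⟩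
    ((y ∙ x ⁻¹) ∙ (x ∙ y ⁻¹)) ∙ s ≈⟨ ∙-congʳ (trans (telescope y x y) (inverseʳ y)) ⟩
    ε ∙ s                         ≈⟨ identityˡ s ⟩
    s                             ∎

  sum-label : ∀ {n} → n > 1 → sum (label n) ≈ ε
  sum-label {1} (s≤s ())
  sum-label {2} _ = sum-pair ε
  sum-label {3} _ = begin
    (y ∙ x ⁻¹) ∙ ((x ∙ z ⁻¹) ∙ ((z ∙ y ⁻¹) ∙ ε)) ≈⟨ ∙-congˡ (∙-congˡ (identityʳ _)) ⟩
    (y ∙ x ⁻¹) ∙ ((x ∙ z ⁻¹) ∙ (z ∙ y ⁻¹))       ≈⟨ ∙-congˡ (telescope x z y) ⟩
    (y ∙ x ⁻¹) ∙ (x ∙ y ⁻¹)                     ≈⟨ telescope y x y ⟩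
    y ∙ y ⁻¹                                    ≈⟨ inverseʳ y ⟩
    ε                                           ∎
  sum-label {ℕ.suc (ℕ.suc (ℕ.suc (ℕ.suc n)))} _ =
    trans (sum-pair _) (sum-label {ℕ.suc (ℕ.suc n)} (s≤s (s≤s z≤n)))

module EdgelessJoin {k : ℕ} (H : SimpleGraph k) (n : Fin k → ℕ) where

  HJoin : FinGraph
  HJoin = Join H (λ j → Edgeless (n j))

  joinAdj-edgeless : ∀ i x j y → adj HJoin (i , x) (j , y) ≡ E H i j
  joinAdj-edgeless i x j y with i ≟ j
  ... | yes ≡.refl = ≡.sym (E-irr H i)
  ... | no _       = ≡.refl

  module _ {c ℓ} (A : AbelianGroup c ℓ) where
    open AbelianGroup A
    open ConditionalSum monoid
    open RawMonoidDefinitions rawMonoid using (sum)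

    blockwise : (∀ j → Vector Carrier (n j)) → V HJoin → Carrier
    blockwise l (j , a) = l j a

    nbrSum-≈ε : (l : ∀ j → Vector Carrier (n j)) → (∀ j → sum (l j) ≈ ε) →
                ∀ v → nbrSum A HJoin (blockwise l) v ≈ ε
    nbrSum-≈ε l sum≈ε (i , x) =
      condSum-concatMap-≈ε p (blockwise l) (λ j → map (j ,_) (allFin (n j))) block-≈ε (allFin k)
      where
      p : V HJoin → Bool
      p = adj HJoin (i , x)

      tabulated-block-≈ε : ∀ j → condSum p (blockwise l) (tabulate (j ,_)) ≈ ε
      tabulated-block-≈ε j with E H i j in eq
      ... | true  = trans (reflexive (condSum-tabulate-true p (blockwise l) (j ,_)
                            (λ a → ≡.trans (joinAdj-edgeless i x j a) eq))) (sum≈ε j)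
      ... | false = reflexive (condSum-tabulate-false p (blockwise l) (j ,_)
                            (λ a → ≡.trans (joinAdj-edgeless i x j a) eq))

      block-≈ε : ∀ j → condSum p (blockwise l) (map (j ,_) (allFin (n j))) ≈ ε
      block-≈ε j = trans (reflexive (≡.cong (condSum p (blockwise l)) (map-tabulate (λ a → a) (j ,_))))
                         (tabulated-block-≈ε j)

mainTheorem6 : ∀ {c ℓ} (k : ℕ) (H : SimpleGraph k) (n : Fin k → ℕ) →
    (∀ j → n j > 1) →
    (A : AbelianGroup c ℓ) → MoreThanTwo A →
    VertexMagic A (Join H (λ j → Edgeless (n j)))
mainTheorem6 k H n n>1 A (x , y , z , x≉y , x≉z , y≉z) =
  blockwise A (λ j → label (n j)) , ε , (λ (j , a) → label-≉ε (n j) a) ,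
  nbrSum-≈ε A (λ j → label (n j)) (λ j → sum-label (n>1 j))
  where
  open AbelianGroup A using (ε)
  open ZeroSumLabelling (AbelianGroup.group A) x≉y x≉z y≉z
  open EdgelessJoin H n
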